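{- Let $Q$ be a basic sequence that is infinite in limit, let $x$ be a real number that is $Q$-ratio normal of order $2$, and let $t$ be a non-negative integer. Then $\lim_{n\to\infty}N_n^Q((t),x)=\infty$.
   Context: A basic sequence is a sequence $Q=\{q_n\}$ of integers $q_n\ge2$; it is infinite in limit if $q_n\to\infty$. The $Q$-Cantor series expansion of $x$ is the unique expansion $x=\lfloor x\rfloor+\sum_{n\ge1}\frac{E_n}{q_1\cdots q_n}$ with $E_n\in\{0,\dots,q_n-1\}$ and $E_n\ne q_n-1$ infinitely often. A block of length $k$ is an ordered $k$-tuple of non-negative integers; $N_n^Q(B,x)$ is the number of times the block $B$ occurs in the digit sequence $(E_j)$ with starting position at most $n$. $x$ is $Q$-ratio normal of order $k$ if for all blocks $B,B'$ of length $k$, $\lim_{n\to\infty}N_n^Q(B,x)/N_n^Q(B',x)=1$. $(t)$ denotes the block of length one consisting of the digit $t$. -}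

module Defs where

open import Data.Nat using (ℕ; zero; suc; _+_; _*_; _∸_; _≤_; _<_; _≟_)
open import Data.Nat.Properties using ()
open import Data.Bool using (Bool; true; false; _∧_)
open import Data.Product using (Σ; _×_; ∃; ∃-syntax)
open import Relation.Nullary using (¬_)
open import Relation.Nullary.Decidable using (⌊_⌋)
open import Relation.Binary.PropositionalEquality using (_≡_)

-- Sequences are indexed from 0: index j here corresponds to index j+1 in the paper.

IsBasicSequence : (ℕ → ℕ) → Set
IsBasicSequence q = ∀ n → 2 ≤ q n

InfiniteInLimit : (ℕ → ℕ) → Set
InfiniteInLimit q = ∀ K → ∃[ M ] (∀ n → M ≤ n → K ≤ q n)

-- E is the digit sequence of a Q-Cantor series expansion:
-- 0 ≤ E n ≤ q n - 1 and E n ≠ q n - 1 infinitely often.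
-- Such sequences correspond bijectively to the fractional parts of reals x.
IsCantorDigits : (ℕ → ℕ) → (ℕ → ℕ) → Set
IsCantorDigits q E =
  (∀ n → E n < q n) × (∀ m → ∃[ n ] (m ≤ n × ¬ (suc (E n) ≡ q n)))

count : (ℕ → Bool) → ℕ → ℕ
count p zero = zero
count p (suc n) with p n
... | true  = suc (count p n)
... | false = count p n

Block2 : Set
Block2 = ℕ × ℕ

-- N_n^Q((t), x): occurrences of digit t at positions 1..n.
N1 : (ℕ → ℕ) → ℕ → ℕ → ℕ
N1 E t n = count (λ j → ⌊ E j ≟ t ⌋) n

-- N_n^Q((a,b), x): occurrences of the block (a,b) starting at positions 1..n.
N2 : (ℕ → ℕ) → ℕ → ℕ → ℕ → ℕ
N2 E a b n = count (λ j → ⌊ E j ≟ a ⌋ ∧ ⌊ E (suc j) ≟ b ⌋) n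

dist : ℕ → ℕ → ℕ
dist m n = (m ∸ n) + (n ∸ m)

-- lim_{n→∞} f n / g n = 1 : for every ε = 1/(k+1), eventually g n > 0 and
-- |f n / g n - 1| < 1/(k+1), i.e. (k+1)·|f n - g n| < g n.
RatioTendsToOne : (ℕ → ℕ) → (ℕ → ℕ) → Set
RatioTendsToOne f g =
  ∀ k → ∃[ M ] (∀ n → M ≤ n → suc k * dist (f n) (g n) < g n)

RatioNormal2 : (ℕ → ℕ) → Set
RatioNormal2 E =
  ∀ a b a' b' → RatioTendsToOne (N2 E a b) (N2 E a' b')

TendsToInfinity : (ℕ → ℕ) → Set
TendsToInfinity f = ∀ K → ∃[ M ] (∀ n → M ≤ n → K ≤ f n)

module Submission where

-- Ratio normality of order 2 forces every block of length 2 to occur: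
-- comparing the count of (t, b) with itself shows N2 E t b n ≥ 1 eventually
-- (the limit of a ratio can only be 1 if its denominator is eventually
-- positive).  Each occurrence of a block (t, b) is an occurrence of the digit
-- t, and the blocks (t, 0), …, (t, K-1) occur at pairwise different places
-- (the digit following position j determines b).  Hence, once all of them
-- have occurred, N1 E t n ≥ K.

open import Defs
open import Data.Nat using (ℕ; zero; suc; _+_; _≤_; _≟_; z≤n; s≤s; _⊔_)
open import Data.Nat.Properties
  using (≤-refl; ≤-reflexive; ≤-trans; +-mono-≤; +-suc; +-comm; m≤n⇒m≤1+n;
         m≤m⊔n; m≤n⊔m; n<1+n; <-irrefl; _<?_)
open import Data.Bool using (Bool; true; false; _∧_)
open import Data.Product using (∃-syntax; _,_; _×_)
open import Relation.Nullary using (yes; no)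
open import Relation.Nullary.Decidable using (⌊_⌋)
open import Relation.Binary.PropositionalEquality using (refl)
open import Data.Empty using (⊥-elim)

-- The indicator of a boolean, so that count p n = Σ_{j<n} ind (p j).
ind : Bool → ℕ
ind true  = 1
ind false = 0

count-superadditive : (p r s : ℕ → Bool) → (∀ j → ind (p j) + ind (r j) ≤ ind (s j)) →
  ∀ n → count p n + count r n ≤ count s n
count-superadditive p r s bound zero = z≤n
count-superadditive p r s bound (suc n)
  with p n | r n | s n | bound n | count-superadditive p r s bound n
... | true  | true  | true  | s≤s () | _
... | true  | true  | false | ()     | _
... | true  | false | true  | _      | ih = s≤s ih
... | false | true  | true  | _      | ih rewrite +-suc (count p n) (count r n) = s≤s ih
... | false | false | true  | _      | ih = m≤n⇒m≤1+n ih
... | false | false | false | _      | ih = ih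
... | true  | false | false | ()     | _
... | false | true  | false | ()     | _

count-mono : (p s : ℕ → Bool) → (∀ j → ind (p j) ≤ ind (s j)) → ∀ n → count p n ≤ count s n
count-mono p s bound zero = z≤n
count-mono p s bound (suc n) with p n | s n | bound n | count-mono p s bound n
... | true  | true  | _  | ih = s≤s ih
... | false | true  | _  | ih = m≤n⇒m≤1+n ih
... | false | false | _  | ih = ih
... | true  | false | () | _

Eventually : (ℕ → Set) → Set
Eventually P = ∃[ M ] (∀ n → M ≤ n → P n)

eventually-both : {P R : ℕ → Set} → Eventually P → Eventually R → Eventually (λ n → P n × R n)
eventually-both (M₁ , p) (M₂ , r) =
  M₁ ⊔ M₂ , λ n M≤n → p n (≤-trans (m≤m⊔n M₁ M₂) M≤n) , r n (≤-trans (m≤n⊔m M₁ M₂) M≤n)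

ind≤1 : ∀ b → ind b ≤ 1
ind≤1 true  = ≤-refl
ind≤1 false = z≤n

-- Every block of length 2 eventually occurs: ratio normality, applied to the
-- block compared with itself, demands a positive denominator.
every-block-occurs : ∀ E → RatioNormal2 E → ∀ a b → Eventually (λ n → 1 ≤ N2 E a b n)
every-block-occurs E normal a b with normal a b a b 0
... | M , ratio = M , λ n M≤n → ≤-trans (s≤s z≤n) (ratio n M≤n)

followedBelow : (ℕ → ℕ) → ℕ → ℕ → ℕ → Bool
followedBelow E t K j = ⌊ E j ≟ t ⌋ ∧ ⌊ E (suc j) <? K ⌋

below-suc : ∀ e K → ind ⌊ e <? K ⌋ + ind ⌊ e ≟ K ⌋ ≤ ind ⌊ e <? suc K ⌋
below-suc e K with e <? K | e ≟ K | e <? suc K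
... | yes e<K | yes refl | _        = ⊥-elim (<-irrefl refl e<K)
... | yes _   | no _     | yes _    = ≤-refl
... | yes e<K | no _     | no e≮1+K = ⊥-elim (e≮1+K (m≤n⇒m≤1+n e<K))
... | no _    | yes refl | yes _    = ≤-refl
... | no _    | yes refl | no e≮1+e = ⊥-elim (e≮1+e (n<1+n e))
... | no _    | no _     | _        = z≤n

followedBelow-suc : ∀ E t K j →
  ind (followedBelow E t K j) + ind (⌊ E j ≟ t ⌋ ∧ ⌊ E (suc j) ≟ K ⌋) ≤ ind (followedBelow E t (suc K) j)
followedBelow-suc E t K j with E j ≟ t
... | yes _ = below-suc (E (suc j)) K
... | no _  = z≤n

followedBelow-digit : ∀ E t K j → ind (followedBelow E t K j) ≤ ind ⌊ E j ≟ t ⌋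
followedBelow-digit E t K j with E j ≟ t
... | yes _ = ind≤1 ⌊ E (suc j) <? K ⌋
... | no _  = z≤n

-- Eventually the digit t has been followed by each of 0, …, K-1, so it has
-- occurred followed by a digit below K at least K times.
followedBelow-grows : ∀ E → RatioNormal2 E → ∀ t K →
  Eventually (λ n → K ≤ count (followedBelow E t K) n)
followedBelow-grows E normal t zero = 0 , λ _ _ → z≤n
followedBelow-grows E normal t (suc K)
  with eventually-both (followedBelow-grows E normal t K) (every-block-occurs E normal t K)
... | M , both = M , λ n M≤n → let (grown , occurs) = both n M≤n in
  ≤-trans (≤-reflexive (+-comm 1 K))
    (≤-trans (+-mono-≤ grown occurs)
             (count-superadditive (followedBelow E t K) (λ j → ⌊ E j ≟ t ⌋ ∧ ⌊ E (suc j) ≟ K ⌋)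
                                  (followedBelow E t (suc K)) (followedBelow-suc E t K) n))

-- The theorem: N_n((t)) ≥ #{t followed by a digit below K} ≥ K eventually.
lemma3p10 : (q E : ℕ → ℕ) → IsBasicSequence q → InfiniteInLimit q →
    IsCantorDigits q E → RatioNormal2 E → (t : ℕ) → TendsToInfinity (N1 E t)
lemma3p10 q E _ _ _ normal t K with followedBelow-grows E normal t K
... | M , grown = M , λ n M≤n →
  ≤-trans (grown n M≤n) (count-mono (followedBelow E t K) (λ j → ⌊ E j ≟ t ⌋) (followedBelow-digit E t K) n)
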